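{- Let $d\geq 2$ and $1\le k\le d+1$. Every $(d+1-k)$-dimensional face of the permutahedral tiling $\mathcal P_d$ can be written uniquely as $[B_1,\dots,B_k]+v$ with $[B_1,\dots,B_k]$ an ordered partition of $[d+1]$ satisfying $1\in B_1$ and $v\in\Lambda_d$.
   Context: $\mathrm{Perm}_d=\operatorname{conv}\{(\sigma(1),\dots,\sigma(d+1)):\sigma\in\mathfrak S_{d+1}\}\subset\mathbb{R}^{d+1}$; $w_i=(d+1)e_i-\sum_je_j$, $\Lambda_d=\mathbb{Z}$-span of the $w_i$. The permutahedral tiling $\mathcal P_d$ is the polytopal complex consisting of the tiles $\mathrm{Perm}_d+v$, $v\in\Lambda_d$, and all their faces. An ordered partition $[B_1,\dots,B_k]$ of $[d+1]$ (nonempty disjoint blocks with union $[d+1]$) labels the $(d+1-k)$-dimensional face of $\mathrm{Perm}_d$ given as the convex hull of all permutation vectors $(x_1,\dots,x_{d+1})$ of $[d+1]$ with $\{x_a: a\in B_i\}=\{b_{i-1}+1,\dots,b_i\}$ for all $i$, where $b_i=|B_1|+\dots+|B_i|$, $b_0=0$; $[B_1,\dots,B_k]+v$ is its translate by $v$.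
   Formalization: The faces $[B_1,\dots,B_k]+v$ are taken as sets of points of ℚ^(d+1), convex combinations with rational weights, rather than as real point sets in $\mathbb{R}^{d+1}$. -}

module Defs where

open import Data.Nat as ℕ using (ℕ; suc)
open import Data.Fin using (Fin; toℕ; _≟_; zero)
open import Data.Fin.Permutation using (Permutation′; _⟨$⟩ʳ_)
open import Data.Integer as ℤ using (ℤ; +_)
open import Data.Rational as ℚ using (ℚ; 0ℚ; 1ℚ)
open import Data.List using (List; length; filter; map; foldr; allFin)
open import Data.List.Relation.Unary.All using (All)
open import Data.Product using (Σ; ∃; _×_; proj₁; proj₂)
open import Function.Bundles using (_⇔_)
open import Relation.Nullary.Decidable using (does)
open import Relation.Binary.PropositionalEquality using (_≡_)

-- Ordered partition [B_1,…,B_k] of [n] = {1..n} (elements encoded as Fin n,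
-- Fin-index a stands for a+1): the block map a ↦ (index of block containing a).
-- Blocks nonempty ⇔ block map surjective.
OrderedPartition : ℕ → ℕ → Set
OrderedPartition n k = Σ (Fin n → Fin k) (λ f → ∀ (i : Fin k) → ∃ λ a → f a ≡ i)

block : ∀ {n k} → OrderedPartition n k → Fin n → Fin k
block = proj₁

OneInFirst : ∀ {m k} → OrderedPartition (suc m) k → Set
OneInFirst B = toℕ (block B zero) ≡ 0

bsum : ∀ {n k} → OrderedPartition n k → ℕ → ℕ
bsum {n} B j = length (filter (λ a → toℕ (block B a) ℕ.<? j) (allFin n))

permVec : ∀ {n} → Permutation′ n → Fin n → ℕ
permVec σ a = suc (toℕ (σ ⟨$⟩ʳ a))

-- σ is a vertex of the face [B_1,…,B_k]:
-- {x_a : a ∈ B_i} = {b_{i-1}+1, …, b_i} for every block i.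
VertexOf : ∀ {n k} → OrderedPartition n k → Permutation′ n → Set
VertexOf {n} {k} B σ =
  ∀ (i : Fin k) (m : ℕ) →
    (∃ λ a → block B a ≡ i × permVec σ a ≡ m)
      ⇔ (bsum B (toℕ i) ℕ.< m × m ℕ.≤ bsum B (suc (toℕ i)))

sumℤ : List ℤ → ℤ
sumℤ = foldr ℤ._+_ (+ 0)

sumℚ : List ℚ → ℚ
sumℚ = foldr ℚ._+_ 0ℚ

-- w_i = (d+1) e_i − Σ_j e_j  (here n = d+1), coordinate j
w : ∀ {n} → Fin n → Fin n → ℤ
w {n} i j = (if does (i ≟ j) then + n else + 0) ℤ.- + 1
  where open import Data.Bool using (if_then_else_)

InLattice : ∀ {n} → (Fin n → ℤ) → Set
InLattice {n} v = ∃ λ (c : Fin n → ℤ) →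
  ∀ j → v j ≡ sumℤ (map (λ i → c i ℤ.* w i j) (allFin n))

toℚ : ℤ → ℚ
toℚ z = z ℚ./ 1

-- Points of ℚ^n.  x ∈ [B]+v  ⇔  x is a convex combination of the vectors
-- (σ + v) with σ a vertex of [B].
InFace : ∀ {n k} → OrderedPartition n k → (Fin n → ℤ) → (Fin n → ℚ) → Set
InFace {n} B v x =
  ∃ λ (L : List (ℚ × Permutation′ n)) →
    All (λ p → (0ℚ ℚ.≤ proj₁ p) × VertexOf B (proj₂ p)) L
    × sumℚ (map proj₁ L) ≡ 1ℚ
    × (∀ j → x j ≡ sumℚ (map (λ p → proj₁ p ℚ.* toℚ (+ permVec (proj₂ p) j ℤ.+ v j)) L))

SameFace : ∀ {n k k'} → OrderedPartition n k → (Fin n → ℤ)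
         → OrderedPartition n k' → (Fin n → ℤ) → Set
SameFace {n} B v B' v' = ∀ (x : Fin n → ℚ) → InFace B v x ⇔ InFace B' v' x

{-# OPTIONS --safe #-}
-- A permutation σ is a vertex of the face [B] exactly when it is a linear extension of B,
-- i.e. σ(a) < σ(b) whenever the block of a precedes the block of b.
--
-- Existence: if 1 lies in B_{j+1}, let s = |B_1| + … + |B_j|.  Composing with the cyclic shift
-- m ↦ m − s (mod d+1) maps the linear extensions of [B_1,…,B_k] onto those of the rotated
-- partition [B_{j+1},…,B_k,B_1,…,B_j], and the shifted σ plus v′ = v − Σ_{i ∈ B_1 ∪ … ∪ B_j} w_i
-- is the point σ + v, so the two faces have the same vertex points; v′ is again in Λ_d.
--
-- Uniqueness: every point x of [B] + v satisfies x_i ≥ 1 + v_i.  Applying this to the vertex of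
-- the other face that fixes 1 gives v_1 = v′_1 and |v_i − v′_i| < d+1; since the coordinates of
-- v − v′ ∈ Λ_d are congruent modulo d+1, v = v′.  Then B and B′ have the same linear extensions,
-- and swapping two elements of a block of B in a linear extension shows that B′ orders blocks as
-- B does.
module Submission where

open import Defs
open import Data.Nat using (ℕ; suc; _≤_)
open import Data.Fin using (Fin)
open import Data.Integer using (ℤ)
open import Data.Product using (∃; ∃₂; _×_)
open import Relation.Binary.PropositionalEquality using (_≡_)

open import Data.Bool using (if_then_else_)
open import Data.Fin as Fin using (toℕ; fromℕ<; punchOut)
open import Data.Fin.Permutation using (Permutation′; permutation; _⟨$⟩ʳ_; _⟨$⟩ˡ_; inverseˡ; inverseʳ;
  transpose; flip; _∘ₚ_)
import Data.Fin.Permutation.Components as PC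
open import Data.Fin.Properties using (toℕ-injective; toℕ-fromℕ<; toℕ<n; punchOut-injective; injective⇒≤;
  any?)
open import Data.Integer as ℤ using (+_; -[1+_]; +[1+_]; 0ℤ; +≤+; +<+)
import Data.Integer.Properties as ℤ
open import Data.Integer.Tactic.RingSolver using (solve-∀)
open import Data.List using (List; []; _∷_; length; filter; map; tabulate; allFin)
open import Data.List.Membership.Propositional using (_∈_)
open import Data.List.Membership.Propositional.Properties using (∈-allFin)
open import Data.List.Properties using (filter-≐; filter-accept; filter-reject; filter-none; filter-some;
  filter-notAll; length-filter; length-tabulate; map-tabulate; map-∘)
open import Data.List.Relation.Binary.Sublist.Propositional using (⊆-refl)
import Data.List.Relation.Binary.Sublist.Propositional.Properties as Sublist
open import Data.List.Relation.Unary.All as All using (All; []; _∷_)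
open import Data.List.Relation.Unary.AllPairs using (_∷_)
open import Data.List.Relation.Unary.Any as Any using (here; there)
open import Data.List.Relation.Unary.Unique.Propositional using (Unique)
open import Data.List.Relation.Unary.Unique.Propositional.Properties using (allFin⁺)
open import Data.Nat using (zero; _+_; _∸_; _<_; z≤n; s≤s; s≤s⁻¹; _<?_)
open import Data.Nat.Properties
open import Data.Product using (_,_; proj₁; proj₂; map₂)
open import Data.Product.Relation.Binary.Lex.Strict using (×-strictTotalOrder)
open import Data.Rational as ℚ using (ℚ; 0ℚ; 1ℚ)
import Data.Rational.Properties as ℚ
open import Data.Rational.Solver using (module +-*-Solver)
import Data.Rational.Unnormalised as ℚᵘ
import Data.Rational.Unnormalised.Properties as ℚᵘ
open import Data.Sum using (_⊎_; inj₁; inj₂)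
open import Function.Base using (id; _∘_)
open import Function.Bundles using (_⇔_; mk⇔; Equivalence)
open import Function.Definitions using (Injective)
open import Function.Properties.Equivalence using (⇔-setoid)
open import Level using (0ℓ)
open import Relation.Binary.Bundles using (StrictTotalOrder)
open import Relation.Binary.Definitions using (DecidableEquality; Tri; tri<; tri≈; tri>)
open import Relation.Binary.PropositionalEquality using (refl; sym; trans; cong; cong₂; subst; subst₂; _≢_;
  ≢-sym; module ≡-Reasoning)
open import Relation.Nullary using (¬_; Dec; yes; no; does; contradiction)
open import Relation.Nullary.Decidable using (_×-dec_; ¬?; dec-true)
open import Relation.Unary as U using (Pred; _⊆_)
open import Relation.Unary.Properties using (∁?)

open Equivalence using (to; from)

-- Counting

count : ∀ {A : Set} {P : Pred A 0ℓ} → U.Decidable P → List A → ℕ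
count P? xs = length (filter P? xs)

module _ {A : Set} {P Q : Pred A 0ℓ} (P? : U.Decidable P) (Q? : U.Decidable Q) where

  count-mono : P ⊆ Q → ∀ xs → count P? xs ≤ count Q? xs
  count-mono P⊆Q xs =
    Sublist.length-mono-≤ (Sublist.filter⁺ P? Q? (λ { refl → P⊆Q }) (⊆-refl {x = xs}))

  count-cong : P ⊆ Q → Q ⊆ P → ∀ xs → count P? xs ≡ count Q? xs
  count-cong P⊆Q Q⊆P xs = cong length (filter-≐ P? Q? (P⊆Q , Q⊆P) xs)

  count-split : ∀ xs →
    count P? xs ≡ count (λ x → P? x ×-dec Q? x) xs + count (λ x → P? x ×-dec ¬? (Q? x)) xs
  count-split [] = refl
  count-split (x ∷ xs) with P? x | Q? x
  ... | yes _ | yes _ = cong suc (count-split xs)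
  ... | yes _ | no _  = trans (cong suc (count-split xs)) (sym (+-suc _ _))
  ... | no _  | yes _ = count-split xs
  ... | no _  | no _  = count-split xs

module _ {A : Set} {P Q : Pred A 0ℓ} (P? : U.Decidable P) (Q? : U.Decidable Q) where

  count-mono-< : P ⊆ Q → ∀ {x} xs → x ∈ xs → Q x → ¬ P x → count P? xs < count Q? xs
  count-mono-< P⊆Q xs x∈xs qx ¬px = begin-strict
    count P? xs
      ≡⟨ count-cong P? (λ y → Q? y ×-dec P? y) (λ p → P⊆Q p , p) proj₂ xs ⟩
    count (λ y → Q? y ×-dec P? y) xs
      <⟨ m<m+n _ (filter-some (λ y → Q? y ×-dec ¬? (P? y)) (Any.map (λ { refl → qx , ¬px }) x∈xs)) ⟩
    count (λ y → Q? y ×-dec P? y) xs + count (λ y → Q? y ×-dec ¬? (P? y)) xs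
      ≡⟨ count-split Q? P? xs ⟨
    count Q? xs ∎
    where open ≤-Reasoning

module _ {A : Set} {P : Pred A 0ℓ} (P? : U.Decidable P) where

  count-complement : ∀ xs → count P? xs + count (∁? P?) xs ≡ length xs
  count-complement [] = refl
  count-complement (x ∷ xs) with P? x
  ... | yes _ = cong suc (count-complement xs)
  ... | no _  = trans (+-suc _ _) (cong suc (count-complement xs))

  count-none : (∀ x → ¬ P x) → ∀ xs → count P? xs ≡ 0
  count-none ¬P xs = cong length (filter-none P? (All.universal ¬P xs))

count-unique : ∀ {A : Set} (_≟_ : DecidableEquality A) {x xs} → Unique xs → x ∈ xs → count (_≟ x) xs ≡ 1
count-unique _≟_ (x∉xs ∷ _) (here refl) = cong length (trans
  (filter-accept (_≟ _) refl)
  (cong (_ ∷_) (filter-none (_≟ _) (All.map (λ x≢y y≡x → x≢y (sym y≡x)) x∉xs))))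
count-unique _≟_ (y∉ys ∷ ys-unique) (there x∈ys) = trans
  (cong length (filter-reject (_≟ _) (All.lookup y∉ys x∈ys)))
  (count-unique _≟_ ys-unique x∈ys)

-- Permutations

injective⇒surjective : ∀ {n} {f : Fin n → Fin n} → Injective _≡_ _≡_ f → ∀ y → ∃ λ x → f x ≡ y
injective⇒surjective {suc n} {f} f-inj y with any? (λ x → f x Fin.≟ y)
... | yes hit = hit
... | no miss = contradiction (injective⇒≤ g-inj) (<-irrefl refl)
  where
  y≢f : ∀ x → y ≢ f x
  y≢f x y≡fx = miss (x , sym y≡fx)
  g : Fin (suc n) → Fin n
  g x = punchOut (y≢f x)
  g-inj : Injective _≡_ _≡_ g
  g-inj gx≡gx′ = f-inj (punchOut-injective (y≢f _) (y≢f _) gx≡gx′)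

injective⇒permutation : ∀ {n} (f : Fin n → Fin n) → Injective _≡_ _≡_ f → Permutation′ n
injective⇒permutation f f-inj =
  permutation f (proj₁ ∘ surj) (proj₂ ∘ surj) (λ x → f-inj (proj₂ (surj (f x))))
  where
  surj : ∀ y → ∃ λ x → f x ≡ y
  surj = injective⇒surjective f-inj

⟦_⟧ : ∀ {n} → Permutation′ n → Fin n → ℕ
⟦ σ ⟧ a = toℕ (σ ⟨$⟩ʳ a)

count-below-permutation : ∀ {n} (σ : Permutation′ n) {m} → m ≤ n →
  count (λ a → ⟦ σ ⟧ a <? m) (allFin n) ≡ m
count-below-permutation {n} σ {zero} _ = count-none (λ a → ⟦ σ ⟧ a <? 0) (λ _ ()) (allFin n)
count-below-permutation {n} σ {suc m} m<n = begin
  count (below (suc m)) xs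
    ≡⟨ count-split (below (suc m)) (below m) xs ⟩
  count (λ a → below (suc m) a ×-dec below m a) xs + count (λ a → below (suc m) a ×-dec ¬? (below m a)) xs
    ≡⟨ cong₂ _+_ (count-cong _ (below m) proj₂ (λ lt → m≤n⇒m≤1+n lt , lt) xs)
                 (count-cong _ (Fin._≟ c) (λ (lt , ≮) → hits-c lt ≮) c-hits xs) ⟩
  count (below m) xs + count (Fin._≟ c) xs
    ≡⟨ cong₂ _+_ (count-below-permutation σ (<⇒≤ m<n)) (count-unique Fin._≟_ (allFin⁺ n) (∈-allFin c)) ⟩
  m + 1
    ≡⟨ +-comm m 1 ⟩
  suc m ∎
  where
  open ≡-Reasoning
  xs : List (Fin n)
  xs = allFin n
  below : ∀ i → U.Decidable (λ a → ⟦ σ ⟧ a < i)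
  below i a = ⟦ σ ⟧ a <? i
  c : Fin n
  c = σ ⟨$⟩ˡ fromℕ< m<n
  hits-c : ∀ {a} → ⟦ σ ⟧ a < suc m → ¬ ⟦ σ ⟧ a < m → a ≡ c
  hits-c {a} lt ≮ = trans (sym (inverseˡ σ)) (cong (σ ⟨$⟩ˡ_) (toℕ-injective
    (trans (≤-antisym (s≤s⁻¹ lt) (≮⇒≥ ≮)) (sym (toℕ-fromℕ< m<n)))))
  c-hits : ∀ {a} → a ≡ c → ⟦ σ ⟧ a < suc m × ¬ ⟦ σ ⟧ a < m
  c-hits refl rewrite inverseʳ σ {fromℕ< m<n} | toℕ-fromℕ< m<n = n<1+n m , <-irrefl refl

transpose-preserves : ∀ {n} {A : Set} (f : Fin n → A) {a b} → f a ≡ f b → ∀ x → f (PC.transpose a b x) ≡ f x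
transpose-preserves f {a} {b} fa≡fb x with x Fin.≟ a
... | yes refl = sym fa≡fb
... | no _ with x Fin.≟ b
...   | yes refl = fa≡fb
...   | no _     = refl

transpose-matchˡ : ∀ {n} (a b : Fin n) → PC.transpose a b a ≡ b
transpose-matchˡ a b rewrite dec-true (a Fin.≟ a) refl = refl

transpose-matchʳ : ∀ {n} (a b : Fin n) → PC.transpose a b b ≡ a
transpose-matchʳ a b with b Fin.≟ a
... | yes b≡a = b≡a
... | no _ rewrite dec-true (b Fin.≟ b) refl = refl

module Ranking {n} (S : StrictTotalOrder 0ℓ 0ℓ 0ℓ) (key : Fin n → StrictTotalOrder.Carrier S)
               (key-injective : ∀ {a b} → StrictTotalOrder._≈_ S (key a) (key b) → a ≡ b) where

  open StrictTotalOrder S using (compare; irrefl; module Eq)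
    renaming (_<_ to _≺_; _<?_ to _≺?_; trans to ≺-trans)

  rank : Fin n → ℕ
  rank a = count (λ b → key b ≺? key a) (allFin n)

  rank-mono : ∀ {a b} → key a ≺ key b → rank a < rank b
  rank-mono {a} ka≺kb =
    count-mono-< _ _ (λ kc≺ka → ≺-trans kc≺ka ka≺kb) (allFin n) (∈-allFin a) ka≺kb (irrefl Eq.refl)

  rank-minimum : ∀ {a} → (∀ b → ¬ key b ≺ key a) → rank a ≡ 0
  rank-minimum {a} nothing-below = count-none (λ b → key b ≺? key a) nothing-below (allFin n)

  rank<n : ∀ a → rank a < n
  rank<n a = subst (rank a <_) (length-tabulate _)
    (filter-notAll _ (allFin n) (Any.map (λ { refl → irrefl Eq.refl }) (∈-allFin a)))

  rank-injective : ∀ {a b} → rank a ≡ rank b → a ≡ b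
  rank-injective {a} {b} eq with compare (key a) (key b)
  ... | tri< ka≺kb _ _ = contradiction eq (<⇒≢ (rank-mono ka≺kb))
  ... | tri≈ _ ka≈kb _ = key-injective ka≈kb
  ... | tri> _ _ kb≺ka = contradiction (sym eq) (<⇒≢ (rank-mono kb≺ka))

  ranking : Permutation′ n
  ranking = injective⇒permutation (λ a → fromℕ< (rank<n a)) λ {a} {b} eq →
    rank-injective (trans (sym (toℕ-fromℕ< (rank<n a))) (trans (cong toℕ eq) (toℕ-fromℕ< (rank<n b))))

  ⟦ranking⟧ : ∀ a → ⟦ ranking ⟧ a ≡ rank a
  ⟦ranking⟧ a = toℕ-fromℕ< (rank<n a)

-- Cyclic shifts

rotate : ℕ → ℕ → ℕ → ℕ
rotate N t m with t ≤? m
... | yes _ = m ∸ t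
... | no  _ = m + (N ∸ t)

module _ (N : ℕ) {t : ℕ} where

  rotate-≥ : ∀ {m} → t ≤ m → rotate N t m ≡ m ∸ t
  rotate-≥ {m} t≤m with t ≤? m
  ... | yes _   = refl
  ... | no  t≰m = contradiction t≤m t≰m

  rotate-< : ∀ {m} → m < t → rotate N t m ≡ m + (N ∸ t)
  rotate-< {m} m<t with t ≤? m
  ... | yes t≤m = contradiction t≤m (<⇒≱ m<t)
  ... | no  _   = refl

  rotate-mono-high : ∀ {m m′} → t ≤ m → t ≤ m′ → rotate N t m < rotate N t m′ ⇔ m < m′
  rotate-mono-high {m} {m′} t≤m t≤m′ rewrite rotate-≥ t≤m | rotate-≥ t≤m′ = mk⇔
    (λ lt → subst₂ _<_ (m∸n+n≡m t≤m) (m∸n+n≡m t≤m′) (+-monoˡ-< t lt))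
    (λ lt → ∸-monoˡ-< lt t≤m)

  rotate-mono-low : ∀ {m m′} → m < t → m′ < t → rotate N t m < rotate N t m′ ⇔ m < m′
  rotate-mono-low {m} {m′} m<t m′<t rewrite rotate-< m<t | rotate-< m′<t =
    mk⇔ (+-cancelʳ-< (N ∸ t) m m′) (+-monoˡ-< (N ∸ t))

  rotate-high<low : ∀ {m m′} → t ≤ m → m < N → m′ < t → rotate N t m < rotate N t m′
  rotate-high<low {m} {m′} t≤m m<N m′<t rewrite rotate-≥ t≤m | rotate-< m′<t =
    <-≤-trans (∸-monoˡ-< m<N t≤m) (m≤n+m (N ∸ t) m′)

  rotate-<-bound : t ≤ N → ∀ {m} → m < N → rotate N t m < N
  rotate-<-bound t≤N {m} m<N with t ≤? m
  ... | yes _   = ≤-<-trans (m∸n≤m m t) m<N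
  ... | no  t≰m = begin-strict
    m + (N ∸ t) <⟨ +-monoˡ-< (N ∸ t) (≰⇒> t≰m) ⟩
    t + (N ∸ t) ≡⟨ m+[n∸m]≡n t≤N ⟩
    N           ∎
    where open ≤-Reasoning

  rotate-<-∸ : ∀ {m} → m < N → rotate N t m < N ∸ t ⇔ t ≤ m
  rotate-<-∸ {m} m<N with t ≤? m
  ... | yes t≤m = mk⇔ (λ _ → t≤m) (λ _ → ∸-monoˡ-< m<N t≤m)
  ... | no  t≰m = mk⇔ (λ lt → contradiction (≤-<-trans (m≤n+m (N ∸ t) m) lt) (<-irrefl refl))
                      (λ t≤m → contradiction t≤m t≰m)

  rotate-<⇒≢ : ∀ {m m′} → m < m′ → m′ < N → rotate N t m ≢ rotate N t m′
  rotate-<⇒≢ {m} {m′} m<m′ m′<N with ≤-<-connex t m | ≤-<-connex t m′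
  ... | inj₁ t≤m | inj₁ t≤m′ = <⇒≢ (from (rotate-mono-high t≤m t≤m′) m<m′)
  ... | inj₂ m<t | inj₂ m′<t = <⇒≢ (from (rotate-mono-low m<t m′<t) m<m′)
  ... | inj₂ m<t | inj₁ t≤m′ = ≢-sym (<⇒≢ (rotate-high<low t≤m′ m′<N m<t))
  ... | inj₁ t≤m | inj₂ m′<t = contradiction (<-trans m<m′ m′<t) (≤⇒≯ t≤m)

  rotate-injective : ∀ {m m′} → m < N → m′ < N → rotate N t m ≡ rotate N t m′ → m ≡ m′
  rotate-injective {m} {m′} m<N m′<N eq with <-cmp m m′
  ... | tri< m<m′ _ _ = contradiction eq (rotate-<⇒≢ m<m′ m′<N)
  ... | tri≈ _ m≡m′ _ = m≡m′
  ... | tri> _ _ m′<m = contradiction (sym eq) (rotate-<⇒≢ m′<m m<N)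

rotation : ∀ {N} t → t ≤ N → Permutation′ N
rotation {N} t t≤N = injective⇒permutation rotateFin λ {m} {m′} eq → toℕ-injective
  (rotate-injective N {t} (toℕ<n m) (toℕ<n m′)
    (trans (sym (toℕ-fromℕ< _)) (trans (cong toℕ eq) (toℕ-fromℕ< _))))
  where
  rotateFin : Fin N → Fin N
  rotateFin m = fromℕ< (rotate-<-bound N t≤N (toℕ<n m))

⟦rotation⟧ : ∀ {N} t (t≤N : t ≤ N) m → ⟦ rotation t t≤N ⟧ m ≡ rotate N t (toℕ m)
⟦rotation⟧ t t≤N m = toℕ-fromℕ< _

Extends : ∀ {A : Set} → (A → ℕ) → (A → ℕ) → Set
Extends g f = ∀ {a b} → f a < f b → g a < g b

extends-cong : ∀ {A : Set} {f f′ g g′ : A → ℕ} → (∀ a → f a ≡ f′ a) → (∀ a → g a ≡ g′ a) →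
  Extends g f → Extends g′ f′
extends-cong f≗f′ g≗g′ g-ext {a} {b} lt =
  subst₂ _<_ (g≗g′ a) (g≗g′ b) (g-ext (subst₂ _<_ (sym (f≗f′ a)) (sym (f≗f′ b)) lt))

module _ {A : Set} {K N t s : ℕ} {f g : A → ℕ} (f<K : ∀ a → f a < K) (g<N : ∀ a → g a < N)
         (same-side : ∀ a → t ≤ f a ⇔ s ≤ g a) where

  private
    side : ∀ a → (t ≤ f a × s ≤ g a) ⊎ (f a < t × g a < s)
    side a with ≤-<-connex t (f a)
    ... | inj₁ t≤fa = inj₁ (t≤fa , to (same-side a) t≤fa)
    ... | inj₂ fa<t = inj₂ (fa<t , ≰⇒> (<⇒≱ fa<t ∘ from (same-side a)))

  -- Both rotations move the same lower part (f < t, equivalently g < s) above the rest.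
  extends-rotate : Extends g f ⇔ Extends (rotate N s ∘ g) (rotate K t ∘ f)
  extends-rotate = mk⇔ rotated unrotated
    where
    rotated : Extends g f → Extends (rotate N s ∘ g) (rotate K t ∘ f)
    rotated g-ext {a} {b} lt with side a | side b
    ... | inj₁ (ha , ha′) | inj₁ (hb , hb′) =
      from (rotate-mono-high N ha′ hb′) (g-ext (to (rotate-mono-high K ha hb) lt))
    ... | inj₂ (la , la′) | inj₂ (lb , lb′) =
      from (rotate-mono-low N la′ lb′) (g-ext (to (rotate-mono-low K la lb) lt))
    ... | inj₁ (_ , ha′)  | inj₂ (_ , lb′)  = rotate-high<low N ha′ (g<N a) lb′
    ... | inj₂ (la , _)   | inj₁ (hb , _)   = contradiction lt (<-asym (rotate-high<low K hb (f<K b) la))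
    unrotated : Extends (rotate N s ∘ g) (rotate K t ∘ f) → Extends g f
    unrotated g-ext {a} {b} lt with side a | side b
    ... | inj₁ (ha , ha′) | inj₁ (hb , hb′) =
      to (rotate-mono-high N ha′ hb′) (g-ext (from (rotate-mono-high K ha hb) lt))
    ... | inj₂ (la , la′) | inj₂ (lb , lb′) =
      to (rotate-mono-low N la′ lb′) (g-ext (from (rotate-mono-low K la lb) lt))
    ... | inj₂ (_ , la′)  | inj₁ (_ , hb′)  = <-≤-trans la′ hb′
    ... | inj₁ (ha , _)   | inj₂ (lb , _)   = contradiction (<-trans lt lb) (≤⇒≯ ha)

-- Vertices as linear extensions

blockℕ : ∀ {n k} → OrderedPartition n k → Fin n → ℕ
blockℕ B a = toℕ (block B a)

module _ {n k} (B : OrderedPartition n k) where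

  bsum-mono : ∀ {i i′} → i ≤ i′ → bsum B i ≤ bsum B i′
  bsum-mono i≤i′ =
    count-mono (λ a → blockℕ B a <? _) (λ a → blockℕ B a <? _) (λ lt → <-≤-trans lt i≤i′) (allFin n)

  bsum-≤ : ∀ i → bsum B i ≤ n
  bsum-≤ i = subst (bsum B i ≤_) (length-tabulate _) (length-filter _ (allFin n))

  extends⇒prefix : ∀ σ → Extends ⟦ σ ⟧ (blockℕ B) → ∀ a i → blockℕ B a < i ⇔ ⟦ σ ⟧ a < bsum B i
  extends⇒prefix σ σ-ext a i = mk⇔ in-prefix in-prefix⁻¹
    where
    open ≤-Reasoning
    not-after : ∀ {b} → ⟦ σ ⟧ b ≤ ⟦ σ ⟧ a → blockℕ B b ≤ blockℕ B a
    not-after σb≤σa = ≮⇒≥ (λ φa<φb → <⇒≱ (σ-ext φa<φb) σb≤σa)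
    in-prefix : blockℕ B a < i → ⟦ σ ⟧ a < bsum B i
    in-prefix φa<i = begin
      suc (⟦ σ ⟧ a)
        ≡⟨ count-below-permutation σ (toℕ<n (σ ⟨$⟩ʳ a)) ⟨
      count (λ b → ⟦ σ ⟧ b <? suc (⟦ σ ⟧ a)) (allFin n)
        ≤⟨ count-mono _ _ (λ σb<1+σa → ≤-<-trans (not-after (s≤s⁻¹ σb<1+σa)) φa<i) (allFin n) ⟩
      bsum B i ∎
    in-prefix⁻¹ : ⟦ σ ⟧ a < bsum B i → blockℕ B a < i
    in-prefix⁻¹ σa<bsum with ≤-<-connex i (blockℕ B a)
    ... | inj₂ φa<i = φa<i
    ... | inj₁ i≤φa = contradiction σa<bsum (≤⇒≯ (begin
      bsum B i
        ≤⟨ count-mono _ _ (λ φb<i → σ-ext (<-≤-trans φb<i i≤φa)) (allFin n) ⟩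
      count (λ b → ⟦ σ ⟧ b <? ⟦ σ ⟧ a) (allFin n)
        ≡⟨ count-below-permutation σ (<⇒≤ (toℕ<n (σ ⟨$⟩ʳ a))) ⟩
      ⟦ σ ⟧ a ∎))

  vertex⇒extends : ∀ {σ} → VertexOf B σ → Extends ⟦ σ ⟧ (blockℕ B)
  vertex⇒extends {σ} σ∈B {a} {b} φa<φb = begin-strict
    ⟦ σ ⟧ a                    <⟨ proj₂ (interval a) ⟩
    bsum B (suc (blockℕ B a))  ≤⟨ bsum-mono φa<φb ⟩
    bsum B (blockℕ B b)        ≤⟨ s≤s⁻¹ (proj₁ (interval b)) ⟩
    ⟦ σ ⟧ b                    ∎
    where
    open ≤-Reasoning
    interval : ∀ a → bsum B (blockℕ B a) < permVec σ a × permVec σ a ≤ bsum B (suc (blockℕ B a))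
    interval a = to (σ∈B (block B a) (permVec σ a)) (a , refl , refl)

  extends⇒vertex : ∀ {σ} → Extends ⟦ σ ⟧ (blockℕ B) → VertexOf B σ
  extends⇒vertex {σ} σ-ext i m = mk⇔ interval (preimage m)
    where
    prefix : ∀ a i → blockℕ B a < i ⇔ ⟦ σ ⟧ a < bsum B i
    prefix = extends⇒prefix σ σ-ext
    interval : (∃ λ a → block B a ≡ i × permVec σ a ≡ m) →
      bsum B (toℕ i) < m × m ≤ bsum B (suc (toℕ i))
    interval (a , refl , refl) =
      s≤s (≮⇒≥ (<-irrefl refl ∘ from (prefix a (blockℕ B a)))) , to (prefix a (suc (blockℕ B a))) (n<1+n _)
    preimage : ∀ m → bsum B (toℕ i) < m × m ≤ bsum B (suc (toℕ i)) →
      ∃ λ a → block B a ≡ i × permVec σ a ≡ m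
    preimage (suc m′) (lo , hi) = a , toℕ-injective φa≡i , cong suc σa≡m′
      where
      m′<n : m′ < n
      m′<n = <-≤-trans hi (bsum-≤ _)
      a : Fin n
      a = σ ⟨$⟩ˡ fromℕ< m′<n
      σa≡m′ : ⟦ σ ⟧ a ≡ m′
      σa≡m′ = trans (cong toℕ (inverseʳ σ)) (toℕ-fromℕ< m′<n)
      φa≡i : blockℕ B a ≡ toℕ i
      φa≡i = ≤-antisym
        (s≤s⁻¹ (from (prefix a (suc (toℕ i))) (subst (_< _) (sym σa≡m′) hi)))
        (≮⇒≥ (λ φa<i → <⇒≱ (to (prefix a (toℕ i)) φa<i) (subst (_ ≤_) (sym σa≡m′) (s≤s⁻¹ lo))))

module Canonical {n k} (B : OrderedPartition n k) =
  Ranking (×-strictTotalOrder <-strictTotalOrder <-strictTotalOrder) (λ a → blockℕ B a , toℕ a)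
          (λ (_ , a≡b) → toℕ-injective a≡b)

canonicalVertex : ∀ {n k} → OrderedPartition n k → Permutation′ n
canonicalVertex = Canonical.ranking

canonicalVertex-extends : ∀ {n k} (B : OrderedPartition n k) → Extends ⟦ canonicalVertex B ⟧ (blockℕ B)
canonicalVertex-extends B {a} {b} φa<φb =
  subst₂ _<_ (sym (⟦ranking⟧ a)) (sym (⟦ranking⟧ b)) (rank-mono (inj₁ φa<φb))
  where open Canonical B

canonicalVertex-first : ∀ {m k} (B : OrderedPartition (suc m) k) → OneInFirst B →
  ⟦ canonicalVertex B ⟧ Fin.zero ≡ 0
canonicalVertex-first B φ0≡0 = trans (⟦ranking⟧ Fin.zero) (rank-minimum nothing-below)
  where
  open Canonical B
  nothing-below : ∀ b → ¬ (blockℕ B b < blockℕ B Fin.zero ⊎ (blockℕ B b ≡ blockℕ B Fin.zero × toℕ b < 0))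
  nothing-below b (inj₁ φb<φ0) = n≮0 (subst (blockℕ B b <_) φ0≡0 φb<φ0)
  nothing-below b (inj₂ (_ , ()))

-- If a and b lie in the same block of B, swapping them in a vertex of B gives another vertex,
-- so vertices of B cannot all put a before b.
extends-of-vertex-inclusion : ∀ {n k k′} (B : OrderedPartition n k) (B′ : OrderedPartition n k′) →
  (∀ σ → Extends ⟦ σ ⟧ (blockℕ B) → Extends ⟦ σ ⟧ (blockℕ B′)) → Extends (blockℕ B) (blockℕ B′)
extends-of-vertex-inclusion {n} B B′ incl {a} {b} φ′a<φ′b = compared (<-cmp (blockℕ B a) (blockℕ B b))
  where
  σ : Permutation′ n
  σ = canonicalVertex B
  σa<σb : ⟦ σ ⟧ a < ⟦ σ ⟧ b
  σa<σb = incl σ (canonicalVertex-extends B) φ′a<φ′b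
  σb<σa : blockℕ B a ≡ blockℕ B b → ⟦ σ ⟧ b < ⟦ σ ⟧ a
  σb<σa φa≡φb = subst₂ (λ x y → ⟦ σ ⟧ x < ⟦ σ ⟧ y) (transpose-matchˡ a b) (transpose-matchʳ a b)
    (incl (transpose a b ∘ₚ σ) τ-ext φ′a<φ′b)
    where
    τ-ext : Extends ⟦ transpose a b ∘ₚ σ ⟧ (blockℕ B)
    τ-ext = extends-cong (transpose-preserves (blockℕ B) φa≡φb) (λ _ → refl) (canonicalVertex-extends B)
  compared : Tri (blockℕ B a < blockℕ B b) (blockℕ B a ≡ blockℕ B b) (blockℕ B b < blockℕ B a) →
    blockℕ B a < blockℕ B b
  compared (tri< φa<φb _ _) = φa<φb
  compared (tri≈ _ φa≡φb _) = contradiction σa<σb (<-asym (σb<σa φa≡φb))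
  compared (tri> _ _ φb<φa) = contradiction σa<σb (<-asym (canonicalVertex-extends B φb<φa))

surjective-extends⇒≤ : ∀ {A : Set} {k} {f : A → Fin k} {g : A → ℕ} → (∀ i → ∃ λ a → f a ≡ i) →
  Extends g (toℕ ∘ f) → ∀ a → toℕ (f a) ≤ g a
surjective-extends⇒≤ {A} {k} {f} {g} f-surj g-ext a = go a refl
  where
  go : ∀ {m} a → toℕ (f a) ≡ m → m ≤ g a
  go {zero}  a _      = z≤n
  go {suc m} a fa≡1+m = ≤-<-trans (go c fc≡m) (g-ext (subst₂ _<_ (sym fc≡m) (sym fa≡1+m) (n<1+n m)))
    where
    m<k : m < k
    m<k = <-trans (n<1+n m) (subst (_< _) fa≡1+m (toℕ<n (f a)))
    c : A
    c = proj₁ (f-surj (fromℕ< m<k))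
    fc≡m : toℕ (f c) ≡ m
    fc≡m = trans (cong toℕ (proj₂ (f-surj (fromℕ< m<k)))) (toℕ-fromℕ< m<k)

same-vertices⇒same-blocks : ∀ {n k} (B B′ : OrderedPartition n k) →
  (∀ σ → VertexOf B σ → VertexOf B′ σ) → (∀ σ → VertexOf B′ σ → VertexOf B σ) →
  ∀ a → block B a ≡ block B′ a
same-vertices⇒same-blocks B B′ B⊆B′ B′⊆B a = toℕ-injective (≤-antisym
  (surjective-extends⇒≤ (proj₂ B) (extends-of-vertex-inclusion B′ B (extension-inclusion B′ B B′⊆B)) a)
  (surjective-extends⇒≤ (proj₂ B′) (extends-of-vertex-inclusion B B′ (extension-inclusion B B′ B⊆B′)) a))
  where
  extension-inclusion : ∀ {k} (C C′ : OrderedPartition _ k) → (∀ σ → VertexOf C σ → VertexOf C′ σ) →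
    ∀ σ → Extends ⟦ σ ⟧ (blockℕ C) → Extends ⟦ σ ⟧ (blockℕ C′)
  extension-inclusion C C′ C⊆C′ σ = vertex⇒extends C′ {σ} ∘ C⊆C′ σ ∘ extends⇒vertex C {σ}

-- Faces as convex hulls

toℚᵘ-toℚ : ∀ z → ℚ.toℚᵘ (toℚ z) ℚᵘ.≃ ℚᵘ.mkℚᵘ z 0
toℚᵘ-toℚ z = ℚ.toℚᵘ-fromℚᵘ (ℚᵘ.mkℚᵘ z 0)

toℚ-mono-≤ : ∀ {a b} → a ℤ.≤ b → toℚ a ℚ.≤ toℚ b
toℚ-mono-≤ {a} {b} a≤b = ℚ.toℚᵘ-cancel-≤
  (ℚᵘ.≤-respʳ-≃ (ℚᵘ.≃-sym (toℚᵘ-toℚ b)) (ℚᵘ.≤-respˡ-≃ (ℚᵘ.≃-sym (toℚᵘ-toℚ a))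
    (ℚᵘ.*≤* (subst₂ ℤ._≤_ (sym (ℤ.*-identityʳ a)) (sym (ℤ.*-identityʳ b)) a≤b))))

toℚ-cancel-≤ : ∀ {a b} → toℚ a ℚ.≤ toℚ b → a ℤ.≤ b
toℚ-cancel-≤ {a} {b} a≤b
  with ℚᵘ.≤-respʳ-≃ (toℚᵘ-toℚ b) (ℚᵘ.≤-respˡ-≃ (toℚᵘ-toℚ a) (ℚ.toℚᵘ-mono-≤ a≤b))
... | ℚᵘ.*≤* a*1≤b*1 = subst₂ ℤ._≤_ (ℤ.*-identityʳ a) (ℤ.*-identityʳ b) a*1≤b*1

toℚ-+ : ∀ a b → toℚ (a ℤ.+ b) ≡ toℚ a ℚ.+ toℚ b
toℚ-+ a b = ℚ.toℚᵘ-injective (ℚᵘ.≃-trans (toℚᵘ-toℚ (a ℤ.+ b)) (ℚᵘ.≃-trans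
  (ℚᵘ.*≡* (denominators-one a b))
  (ℚᵘ.≃-sym (ℚᵘ.≃-trans (ℚ.toℚᵘ-homo-+ (toℚ a) (toℚ b)) (ℚᵘ.+-cong (toℚᵘ-toℚ a) (toℚᵘ-toℚ b))))))
  where
  denominators-one : ∀ a b → (a ℤ.+ b) ℤ.* + 1 ≡ (a ℤ.* + 1 ℤ.+ b ℤ.* + 1) ℤ.* + 1
  denominators-one = solve-∀

module _ {X : Set} where

  totalWeight : List (ℚ × X) → ℚ
  totalWeight L = sumℚ (map proj₁ L)

  weighted : List (ℚ × X) → (X → ℚ) → ℚ
  weighted L f = sumℚ (map (λ p → proj₁ p ℚ.* f (proj₂ p)) L)

  weighted-mono : ∀ {P : X → Set} {f g : X → ℚ} (L : List (ℚ × X)) →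
    All (λ p → 0ℚ ℚ.≤ proj₁ p × P (proj₂ p)) L → (∀ x → P x → f x ℚ.≤ g x) →
    weighted L f ℚ.≤ weighted L g
  weighted-mono [] [] f≤g = ℚ.≤-refl
  weighted-mono ((λ₀ , x) ∷ L) ((0≤λ₀ , px) ∷ ps) f≤g =
    ℚ.+-mono-≤ (ℚ.*-monoˡ-≤-nonNeg λ₀ {{ℚ.nonNegative 0≤λ₀}} (f≤g x px)) (weighted-mono L ps f≤g)

  weighted-+ : ∀ (f : X → ℚ) c L → weighted L (λ x → f x ℚ.+ c) ≡ weighted L f ℚ.+ c ℚ.* totalWeight L
  weighted-+ f c [] = sym (trans (cong (0ℚ ℚ.+_) (ℚ.*-zeroʳ c)) (ℚ.+-identityˡ 0ℚ))
  weighted-+ f c ((λ₀ , x) ∷ L) = trans (cong (λ₀ ℚ.* (f x ℚ.+ c) ℚ.+_) (weighted-+ f c L))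
    (solve 5 (λ l a c r w → l :* (a :+ c) :+ (r :+ c :* w) := (l :* a :+ r) :+ c :* (l :+ w)) refl
      λ₀ (f x) c (weighted L f) (totalWeight L))
    where open +-*-Solver

  weighted-const : ∀ c L → weighted L (λ _ → c) ≡ c ℚ.* totalWeight L
  weighted-const c [] = sym (ℚ.*-zeroʳ c)
  weighted-const c ((λ₀ , _) ∷ L) = trans (cong (λ₀ ℚ.* c ℚ.+_) (weighted-const c L))
    (solve 3 (λ l c w → l :* c :+ c :* w := c :* (l :+ w)) refl λ₀ c (totalWeight L))
    where open +-*-Solver

vertexPoint : ∀ {n} → Permutation′ n → (Fin n → ℤ) → Fin n → ℤ
vertexPoint σ v j = + permVec σ j ℤ.+ v j

module _ {n k} (B : OrderedPartition n k) (v : Fin n → ℤ) where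

  face-≥ : ∀ {x} → InFace B v x → ∀ c j → (∀ σ → VertexOf B σ → c ℤ.≤ vertexPoint σ v j) → toℚ c ℚ.≤ x j
  face-≥ (L , L⊆B , total≡1 , x≡) c j c≤vertex = subst₂ ℚ._≤_
    (trans (weighted-const (toℚ c) L) (trans (cong (toℚ c ℚ.*_) total≡1) (ℚ.*-identityʳ (toℚ c))))
    (sym (x≡ j))
    (weighted-mono L L⊆B (λ σ σ∈B → toℚ-mono-≤ (c≤vertex σ σ∈B)))

  face-gap : ∀ {x} → InFace B v x → ∀ c a b →
    (∀ σ → VertexOf B σ → vertexPoint σ v a ℤ.+ c ℤ.≤ vertexPoint σ v b) → x a ℚ.+ toℚ c ℚ.≤ x b
  face-gap (L , L⊆B , total≡1 , x≡) c a b gap = subst₂ ℚ._≤_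
    (trans (weighted-+ _ (toℚ c) L)
           (cong₂ ℚ._+_ (sym (x≡ a)) (trans (cong (toℚ c ℚ.*_) total≡1) (ℚ.*-identityʳ (toℚ c)))))
    (sym (x≡ b))
    (weighted-mono L L⊆B (λ σ σ∈B →
      subst (ℚ._≤ _) (toℚ-+ (vertexPoint σ v a) c) (toℚ-mono-≤ (gap σ σ∈B))))

vertexPoint-inFace : ∀ {n k} (B : OrderedPartition n k) σ (v : Fin n → ℤ) →
  VertexOf B σ → InFace B v (toℚ ∘ vertexPoint σ v)
vertexPoint-inFace B σ v σ∈B =
  ((1ℚ , σ) ∷ []) , ((toℚ-mono-≤ (+≤+ (z≤n {1})) , σ∈B) ∷ []) , ℚ.+-identityʳ 1ℚ ,
  λ j → sym (trans (ℚ.+-identityʳ _) (ℚ.*-identityˡ _))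

face-transport : ∀ {n k k′} (B : OrderedPartition n k) (B′ : OrderedPartition n k′) (v v′ : Fin n → ℤ)
  (g : Permutation′ n → Permutation′ n) →
  (∀ σ → VertexOf B σ → VertexOf B′ (g σ) × (∀ j → vertexPoint (g σ) v′ j ≡ vertexPoint σ v j)) →
  ∀ {x} → InFace B v x → InFace B′ v′ x
face-transport B B′ v v′ g g-ok (L , L⊆B , total≡1 , x≡) =
  map (map₂ g) L , moved L L⊆B , trans (cong sumℚ (sym (map-∘ L))) total≡1 ,
  λ j → trans (x≡ j) (sym (same-point L L⊆B j))
  where
  moved : ∀ L → All (λ p → 0ℚ ℚ.≤ proj₁ p × VertexOf B (proj₂ p)) L →
    All (λ p → 0ℚ ℚ.≤ proj₁ p × VertexOf B′ (proj₂ p)) (map (map₂ g) L)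
  moved [] [] = []
  moved ((_ , σ) ∷ L) ((0≤λ₀ , σ∈B) ∷ L⊆B) = (0≤λ₀ , proj₁ (g-ok σ σ∈B)) ∷ moved L L⊆B
  same-point : ∀ L → All (λ p → 0ℚ ℚ.≤ proj₁ p × VertexOf B (proj₂ p)) L → ∀ j →
    weighted (map (map₂ g) L) (λ σ → toℚ (vertexPoint σ v′ j)) ≡
    weighted L (λ σ → toℚ (vertexPoint σ v j))
  same-point [] [] j = refl
  same-point ((λ₀ , σ) ∷ L) ((_ , σ∈B) ∷ L⊆B) j =
    cong₂ ℚ._+_ (cong (λ z → λ₀ ℚ.* toℚ z) (proj₂ (g-ok σ σ∈B) j)) (same-point L L⊆B j)

face-offset : ∀ {n k} (B : OrderedPartition n k) {v v′ : Fin n → ℤ} → (∀ j → v j ≡ v′ j) →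
  ∀ {x} → InFace B v x → InFace B v′ x
face-offset B {v} {v′} v≗v′ = face-transport B B v v′ id
  (λ σ σ∈B → σ∈B , λ j → cong (λ u → + permVec σ j ℤ.+ u) (sym (v≗v′ j)))

private
  +-[-]-cancel : ∀ i j → i ℤ.+ j ℤ.- j ≡ i
  +-[-]-cancel = solve-∀

  gap-identity : ∀ p u w → (+ 1 ℤ.+ p ℤ.+ u) ℤ.+ (+ 1 ℤ.+ (w ℤ.- u)) ≡ + 1 ℤ.+ (+ 1 ℤ.+ p) ℤ.+ w
  gap-identity = solve-∀

  ℤ-+-cancelʳ-≤ : ∀ i {j k} → j ℤ.+ i ℤ.≤ k ℤ.+ i → j ℤ.≤ k
  ℤ-+-cancelʳ-≤ i {j} {k} le =
    subst₂ ℤ._≤_ (+-[-]-cancel j i) (+-[-]-cancel k i) (ℤ.+-monoˡ-≤ (ℤ.- i) le)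

  1+i≤k+j⇒i-j<k : ∀ {i j k} → + 1 ℤ.+ i ℤ.≤ k ℤ.+ j → i ℤ.- j ℤ.< k
  1+i≤k+j⇒i-j<k {i} {j} {k} le =
    subst (i ℤ.- j ℤ.<_) (+-[-]-cancel k j) (ℤ.+-monoˡ-< (ℤ.- j) (ℤ.suc[i]≤j⇒i<j {i} le))

module _ {n k} (B : OrderedPartition n k) (σ : Permutation′ n) (v : Fin n → ℤ) where

  vertexPoint∈face⇒vertex : InFace B v (toℚ ∘ vertexPoint σ v) → VertexOf B σ
  vertexPoint∈face⇒vertex σ∈face = extends⇒vertex B {σ} σ-ext
    where
    σ-ext : Extends ⟦ σ ⟧ (blockℕ B)
    σ-ext {a} {b} φa<φb = gap⇒< (toℚ-cancel-≤ (subst (ℚ._≤ _) (sym (toℚ-+ (vertexPoint σ v a) c))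
      (face-gap B v σ∈face c a b (λ τ τ∈B → <⇒gap τ (vertex⇒extends B {τ} τ∈B φa<φb)))))
      where
      c : ℤ
      c = + 1 ℤ.+ (v b ℤ.- v a)
      <⇒gap : ∀ τ → ⟦ τ ⟧ a < ⟦ τ ⟧ b → vertexPoint τ v a ℤ.+ c ℤ.≤ vertexPoint τ v b
      <⇒gap τ lt = subst (ℤ._≤ _) (sym (gap-identity (+ ⟦ τ ⟧ a) (v a) (v b)))
        (ℤ.+-monoˡ-≤ (v b) (+≤+ (s≤s lt)))
      gap⇒< : vertexPoint σ v a ℤ.+ c ℤ.≤ vertexPoint σ v b → ⟦ σ ⟧ a < ⟦ σ ⟧ b
      gap⇒< le = s≤s⁻¹ (ℤ.drop‿+≤+ (ℤ-+-cancelʳ-≤ (v b)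
        (subst (ℤ._≤ _) (gap-identity (+ ⟦ σ ⟧ a) (v a) (v b)) le)))

  vertexPoint∈face⇒offset-< : ∀ {v′} → InFace B v (toℚ ∘ vertexPoint σ v′) →
    ∀ j → v j ℤ.- v′ j ℤ.< + suc (⟦ σ ⟧ j)
  vertexPoint∈face⇒offset-< {v′} σ∈face j = 1+i≤k+j⇒i-j<k {v j} {v′ j} (toℚ-cancel-≤
    (face-≥ B v σ∈face (+ 1 ℤ.+ v j) j (λ τ _ → ℤ.+-monoˡ-≤ (v j) (+≤+ (s≤s (z≤n {⟦ τ ⟧ j}))))))

-- The lattice Λ_d

∑ : ∀ {n} → (Fin n → ℤ) → ℤ
∑ f = sumℤ (tabulate f)

∑-negate : ∀ {n} (f : Fin n → ℤ) → ∑ (λ i → f i ℤ.* (+ 0 ℤ.- + 1)) ≡ ℤ.- ∑ f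
∑-negate {zero}  f = refl
∑-negate {suc n} f =
  trans (cong (λ s → f Fin.zero ℤ.* (+ 0 ℤ.- + 1) ℤ.+ s) (∑-negate (λ i → f (Fin.suc i))))
        (negate-step (f Fin.zero) (∑ (λ i → f (Fin.suc i))))
  where
  negate-step : ∀ a s → a ℤ.* (+ 0 ℤ.- + 1) ℤ.+ ℤ.- s ≡ ℤ.- (a ℤ.+ s)
  negate-step = solve-∀

∑-sub : ∀ {n} (f g : Fin n → ℤ) → ∑ (λ i → f i ℤ.- g i) ≡ ∑ f ℤ.- ∑ g
∑-sub {zero}  f g = refl
∑-sub {suc n} f g =
  trans (cong (λ s → (f Fin.zero ℤ.- g Fin.zero) ℤ.+ s) (∑-sub (λ i → f (Fin.suc i)) (λ i → g (Fin.suc i))))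
        (sub-step (f Fin.zero) (g Fin.zero) (∑ (λ i → f (Fin.suc i))) (∑ (λ i → g (Fin.suc i))))
  where
  sub-step : ∀ a b s t → (a ℤ.- b) ℤ.+ (s ℤ.- t) ≡ (a ℤ.+ s) ℤ.- (b ℤ.+ t)
  sub-step = solve-∀

-- The diagonal entry N of w is kept apart from the length of the sum so that the induction goes through.
∑-δ : ∀ {n} (c : Fin n → ℤ) (j : Fin n) (N : ℤ) →
  ∑ (λ i → c i ℤ.* ((if does (i Fin.≟ j) then N else + 0) ℤ.- + 1)) ≡ N ℤ.* c j ℤ.- ∑ c
∑-δ {suc n} c Fin.zero N =
  trans (cong (λ s → c Fin.zero ℤ.* (N ℤ.- + 1) ℤ.+ s) (∑-negate (λ i → c (Fin.suc i))))
        (head-step N (c Fin.zero) (∑ (λ i → c (Fin.suc i))))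
  where
  head-step : ∀ N a s → a ℤ.* (N ℤ.- + 1) ℤ.+ ℤ.- s ≡ N ℤ.* a ℤ.- (a ℤ.+ s)
  head-step = solve-∀
∑-δ {suc n} c (Fin.suc j) N =
  trans (cong (λ s → c Fin.zero ℤ.* (+ 0 ℤ.- + 1) ℤ.+ s) (∑-δ (λ i → c (Fin.suc i)) j N))
        (tail-step N (c Fin.zero) (c (Fin.suc j)) (∑ (λ i → c (Fin.suc i))))
  where
  tail-step : ∀ N a b s → a ℤ.* (+ 0 ℤ.- + 1) ℤ.+ (N ℤ.* b ℤ.- s) ≡ N ℤ.* b ℤ.- (a ℤ.+ s)
  tail-step = solve-∀

module _ {n : ℕ} where

  span-coordinate : ∀ (c : Fin n → ℤ) j →
    sumℤ (map (λ i → c i ℤ.* w i j) (allFin n)) ≡ + n ℤ.* c j ℤ.- ∑ c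
  span-coordinate c j = trans (cong sumℤ (map-tabulate id (λ i → c i ℤ.* w i j))) (∑-δ c j (+ n))

  inLattice-form : ∀ {v : Fin n → ℤ} → InLattice v → ∃ λ c → ∀ j → v j ≡ + n ℤ.* c j ℤ.- ∑ c
  inLattice-form (c , v≡) = c , λ j → trans (v≡ j) (span-coordinate c j)

  inLattice-intro : ∀ (c : Fin n → ℤ) → InLattice (λ j → + n ℤ.* c j ℤ.- ∑ c)
  inLattice-intro c = c , λ j → sym (span-coordinate c j)

  inLattice-sub : ∀ {u v : Fin n → ℤ} → InLattice u → InLattice v → InLattice (λ j → u j ℤ.- v j)
  inLattice-sub {u} {v} u∈Λ v∈Λ with inLattice-form u∈Λ | inLattice-form v∈Λ
  ... | c , u≡ | c′ , v≡ = d , λ j → begin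
    u j ℤ.- v j                                          ≡⟨ cong₂ ℤ._-_ (u≡ j) (v≡ j) ⟩
    (+ n ℤ.* c j ℤ.- ∑ c) ℤ.- (+ n ℤ.* c′ j ℤ.- ∑ c′)   ≡⟨ sub-sub (+ n) (c j) (c′ j) (∑ c) (∑ c′) ⟩
    + n ℤ.* d j ℤ.- (∑ c ℤ.- ∑ c′)                       ≡⟨ cong (λ s → + n ℤ.* d j ℤ.- s) (∑-sub c c′) ⟨
    + n ℤ.* d j ℤ.- ∑ d                                  ≡⟨ span-coordinate d j ⟨
    sumℤ (map (λ i → d i ℤ.* w i j) (allFin n))          ∎
    where
    open ≡-Reasoning
    d : Fin n → ℤ
    d i = c i ℤ.- c′ i
    sub-sub : ∀ N a b s s′ → (N ℤ.* a ℤ.- s) ℤ.- (N ℤ.* b ℤ.- s′) ≡ N ℤ.* (a ℤ.- b) ℤ.- (s ℤ.- s′)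
    sub-sub = solve-∀

  inLattice-congruent : ∀ {v : Fin n → ℤ} → InLattice v → ∀ i j → ∃ λ t → v i ℤ.- v j ≡ + n ℤ.* t
  inLattice-congruent v∈Λ i j with inLattice-form v∈Λ
  ... | c , v≡ = c i ℤ.- c j , trans (cong₂ ℤ._-_ (v≡ i) (v≡ j)) (sub-common (+ n) (c i) (c j) (∑ c))
    where
    sub-common : ∀ N a b s → (N ℤ.* a ℤ.- s) ℤ.- (N ℤ.* b ℤ.- s) ≡ N ℤ.* (a ℤ.- b)
    sub-common = solve-∀

bounded-multiple⇒≡ : ∀ {n t i j} → + n ℤ.* t ≡ i ℤ.- j → i ℤ.- j ℤ.< + n → j ℤ.- i ℤ.< + n → i ≡ j
bounded-multiple⇒≡ {n} {t} {i} {j} nt≡i-j i-j<n j-i<n =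
  ℤ.i-j≡0⇒i≡j i j (trans (sym nt≡i-j)
    (trans (cong (+ n ℤ.*_) (unit-bounded⇒zero t<1 -t<1)) (ℤ.*-zeroʳ (+ n))))
  where
  unit-bounded⇒zero : ∀ {t} → t ℤ.< + 1 → ℤ.- t ℤ.< + 1 → t ≡ 0ℤ
  unit-bounded⇒zero {+ zero}    _            _            = refl
  unit-bounded⇒zero {+[1+ _ ]}  (+<+ (s≤s ())) _
  unit-bounded⇒zero { -[1+ _ ]} _            (+<+ (s≤s ()))
  negate-sub : ∀ i j → ℤ.- (i ℤ.- j) ≡ j ℤ.- i
  negate-sub = solve-∀
  t<1 : t ℤ.< + 1
  t<1 = ℤ.*-cancelˡ-<-nonNeg (+ n) (subst₂ ℤ._<_ (sym nt≡i-j) (sym (ℤ.*-identityʳ (+ n))) i-j<n)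
  -t<1 : ℤ.- t ℤ.< + 1
  -t<1 = ℤ.*-cancelˡ-<-nonNeg (+ n) (subst₂ ℤ._<_
    (sym (trans (sym (ℤ.neg-distribʳ-* (+ n) t)) (trans (cong ℤ.-_ nt≡i-j) (negate-sub i j))))
    (sym (ℤ.*-identityʳ (+ n))) j-i<n)

indicator : ∀ {P : Set} → Dec P → ℤ
indicator P? = if does P? then + 1 else + 0

indicator-yes : ∀ {P : Set} (P? : Dec P) → P → indicator P? ≡ + 1
indicator-yes (yes _) _ = refl
indicator-yes (no ¬p) p = contradiction p ¬p

indicator-no : ∀ {P : Set} (P? : Dec P) → ¬ P → indicator P? ≡ + 0
indicator-no (yes p) ¬p = contradiction p ¬p
indicator-no (no _)  _  = refl

indicator-cong : ∀ {P Q : Set} (P? : Dec P) (Q? : Dec Q) → P ⇔ Q → indicator P? ≡ indicator Q?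
indicator-cong (yes _) (yes _) _   = refl
indicator-cong (no _)  (no _)  _   = refl
indicator-cong (yes p) (no ¬q) P⇔Q = contradiction (to P⇔Q p) ¬q
indicator-cong (no ¬p) (yes q) P⇔Q = contradiction (from P⇔Q q) ¬p

sum-indicator : ∀ {A : Set} {P : Pred A 0ℓ} (P? : U.Decidable P) xs →
  sumℤ (map (λ a → indicator (P? a)) xs) ≡ + count P? xs
sum-indicator P? [] = refl
sum-indicator P? (x ∷ xs) with P? x
... | yes _ = cong ℤ.suc (sum-indicator P? xs)
... | no _  = trans (ℤ.+-identityˡ _) (sum-indicator P? xs)

∑-indicator : ∀ {n} {P : Pred (Fin n) 0ℓ} (P? : U.Decidable P) →
  ∑ (λ a → indicator (P? a)) ≡ + count P? (allFin n)
∑-indicator {n} P? =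
  trans (cong sumℤ (sym (map-tabulate {n = n} id (λ a → indicator (P? a))))) (sum-indicator P? (allFin n))

-- Existence

+[m∸n]≡+m-+n : ∀ {m n} → n ≤ m → + (m ∸ n) ≡ + m ℤ.- + n
+[m∸n]≡+m-+n {m} {n} n≤m = sym (trans (ℤ.[+m]-[+n]≡m⊖n m n) (ℤ.⊖-≥ n≤m))

rotate-ℤ : ∀ {N s} m → s ≤ N → + rotate N s m ≡ (+ m ℤ.+ + N ℤ.* indicator (m <? s)) ℤ.- + s
rotate-ℤ {N} {s} m s≤N with ≤-<-connex s m
... | inj₂ m<s rewrite rotate-< N m<s | indicator-yes (m <? s) m<s =
  trans (cong (λ d → + m ℤ.+ d) (+[m∸n]≡+m-+n s≤N)) (wrap (+ m) (+ N) (+ s))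
  where
  wrap : ∀ p q r → p ℤ.+ (q ℤ.- r) ≡ (p ℤ.+ q ℤ.* + 1) ℤ.- r
  wrap = solve-∀
... | inj₁ s≤m rewrite rotate-≥ N s≤m | indicator-no (m <? s) (≤⇒≯ s≤m) =
  trans (+[m∸n]≡+m-+n s≤m) (shift (+ m) (+ N) (+ s))
  where
  shift : ∀ p q r → p ℤ.- r ≡ (p ℤ.+ q ℤ.* + 0) ℤ.- r
  shift = solve-∀

relabel : ∀ {n k} → Permutation′ k → OrderedPartition n k → OrderedPartition n k
relabel π B = (λ a → π ⟨$⟩ʳ block B a) , λ i →
  proj₁ (proj₂ B (π ⟨$⟩ˡ i)) , trans (cong (π ⟨$⟩ʳ_) (proj₂ (proj₂ B (π ⟨$⟩ˡ i)))) (inverseʳ π)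

module RotatedFace {m k} (B : OrderedPartition (suc m) k) (v : Fin (suc m) → ℤ) where

  n : ℕ
  n = suc m

  -- 0-based index of the block containing the element 1 (that is, Fin.zero)
  j : ℕ
  j = blockℕ B Fin.zero

  j≤k : j ≤ k
  j≤k = <⇒≤ (toℕ<n (block B Fin.zero))

  s : ℕ
  s = bsum B j

  s≤n : s ≤ n
  s≤n = bsum-≤ B j

  B′ : OrderedPartition n k
  B′ = relabel (rotation j j≤k) B

  blockℕ-B′ : ∀ a → blockℕ B′ a ≡ rotate k j (blockℕ B a)
  blockℕ-B′ a = ⟦rotation⟧ j j≤k (block B a)

  B′-oneInFirst : OneInFirst B′
  B′-oneInFirst = trans (blockℕ-B′ Fin.zero) (trans (rotate-≥ k (≤-refl {j})) (n∸n≡0 j))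

  e : Fin n → ℤ
  e a = indicator (blockℕ B a <? j)

  ∑e≡s : ∑ e ≡ + s
  ∑e≡s = ∑-indicator (λ a → blockℕ B a <? j)

  -- v′ = v − Σ_{i ∈ B_1 ∪ … ∪ B_j} w_i (see span-coordinate)
  v′ : Fin n → ℤ
  v′ a = v a ℤ.- (+ n ℤ.* e a ℤ.- ∑ e)

  v′-inLattice : InLattice v → InLattice v′
  v′-inLattice v∈Λ = inLattice-sub v∈Λ (inLattice-intro e)

  ρ : Permutation′ n
  ρ = rotation s s≤n

  same-side : ∀ σ → Extends ⟦ σ ⟧ (blockℕ B) → ∀ a → j ≤ blockℕ B a ⇔ s ≤ ⟦ σ ⟧ a
  same-side σ σ-ext a = mk⇔
    (λ j≤φa → ≮⇒≥ (λ σa<s → <⇒≱ (from prefix σa<s) j≤φa))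
    (λ s≤σa → ≮⇒≥ (λ φa<j → <⇒≱ (to prefix φa<j) s≤σa))
    where
    prefix : blockℕ B a < j ⇔ ⟦ σ ⟧ a < s
    prefix = extends⇒prefix B σ σ-ext a j

  extends-forward : ∀ σ → Extends ⟦ σ ⟧ (blockℕ B) → Extends ⟦ σ ∘ₚ ρ ⟧ (blockℕ B′)
  extends-forward σ σ-ext = extends-cong (sym ∘ blockℕ-B′) (λ a → sym (⟦rotation⟧ s s≤n (σ ⟨$⟩ʳ a)))
    (to (extends-rotate (toℕ<n ∘ block B) (toℕ<n ∘ (σ ⟨$⟩ʳ_)) (same-side σ σ-ext)) σ-ext)

  bsum-B′ : bsum B′ (k ∸ j) ≡ n ∸ s
  bsum-B′ = begin
    bsum B′ (k ∸ j)
      ≡⟨ count-cong (λ a → blockℕ B′ a <? k ∸ j) (∁? (λ a → blockℕ B a <? j)) high high⁻¹ (allFin n) ⟩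
    count (∁? (λ a → blockℕ B a <? j)) (allFin n)
      ≡⟨ m+n∸m≡n s _ ⟨
    (s + count (∁? (λ a → blockℕ B a <? j)) (allFin n)) ∸ s
      ≡⟨ cong (_∸ s) (trans (count-complement (λ a → blockℕ B a <? j) (allFin n))
                            (length-tabulate {n = n} id)) ⟩
    n ∸ s ∎
    where
    open ≡-Reasoning
    high : ∀ {a} → blockℕ B′ a < k ∸ j → ¬ blockℕ B a < j
    high {a} lt = ≤⇒≯ (to (rotate-<-∸ k (toℕ<n (block B a))) (subst (_< k ∸ j) (blockℕ-B′ a) lt))
    high⁻¹ : ∀ {a} → ¬ blockℕ B a < j → blockℕ B′ a < k ∸ j
    high⁻¹ {a} ≮ =
      subst (_< k ∸ j) (sym (blockℕ-B′ a)) (from (rotate-<-∸ k (toℕ<n (block B a))) (≮⇒≥ ≮))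

  ⟦⟧-unrotate : ∀ τ a → ⟦ τ ⟧ a ≡ rotate n s (⟦ τ ∘ₚ flip ρ ⟧ a)
  ⟦⟧-unrotate τ a = trans (cong toℕ (sym (inverseʳ ρ))) (⟦rotation⟧ s s≤n _)

  same-side′ : ∀ τ → Extends ⟦ τ ⟧ (blockℕ B′) → ∀ a → j ≤ blockℕ B a ⇔ s ≤ ⟦ τ ∘ₚ flip ρ ⟧ a
  same-side′ τ τ-ext a = begin
    j ≤ blockℕ B a                           ≈⟨ rotate-<-∸ k (toℕ<n (block B a)) ⟨
    rotate k j (blockℕ B a) < k ∸ j          ≡⟨ cong (_< k ∸ j) (blockℕ-B′ a) ⟨
    blockℕ B′ a < k ∸ j                      ≈⟨ extends⇒prefix B′ τ τ-ext a (k ∸ j) ⟩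
    ⟦ τ ⟧ a < bsum B′ (k ∸ j)                ≡⟨ cong₂ _<_ (⟦⟧-unrotate τ a) bsum-B′ ⟩
    rotate n s (⟦ τ ∘ₚ flip ρ ⟧ a) < n ∸ s   ≈⟨ rotate-<-∸ n (toℕ<n _) ⟩
    s ≤ ⟦ τ ∘ₚ flip ρ ⟧ a                    ∎
    where open import Relation.Binary.Reasoning.Setoid (⇔-setoid 0ℓ)

  extends-backward : ∀ τ → Extends ⟦ τ ⟧ (blockℕ B′) → Extends ⟦ τ ∘ₚ flip ρ ⟧ (blockℕ B)
  extends-backward τ τ-ext =
    from (extends-rotate (toℕ<n ∘ block B) (toℕ<n ∘ ((τ ∘ₚ flip ρ) ⟨$⟩ʳ_)) (same-side′ τ τ-ext))
         (extends-cong blockℕ-B′ (⟦⟧-unrotate τ) τ-ext)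

  vertexPoint-forward : ∀ σ → Extends ⟦ σ ⟧ (blockℕ B) →
    ∀ a → vertexPoint (σ ∘ₚ ρ) v′ a ≡ vertexPoint σ v a
  vertexPoint-forward σ σ-ext a = begin
    + 1 ℤ.+ + ⟦ σ ∘ₚ ρ ⟧ a ℤ.+ v′ a
      ≡⟨ cong₂ (λ r d → + 1 ℤ.+ r ℤ.+ (v a ℤ.- (+ n ℤ.* e a ℤ.- d)))
               (trans (cong +_ (⟦rotation⟧ s s≤n _)) (rotate-ℤ _ s≤n)) ∑e≡s ⟩
    + 1 ℤ.+ ((+ ⟦ σ ⟧ a ℤ.+ + n ℤ.* indicator (⟦ σ ⟧ a <? s)) ℤ.- + s) ℤ.+ (v a ℤ.- (+ n ℤ.* e a ℤ.- + s))
      ≡⟨ cong (λ i → + 1 ℤ.+ ((+ ⟦ σ ⟧ a ℤ.+ + n ℤ.* i) ℤ.- + s) ℤ.+ (v a ℤ.- (+ n ℤ.* e a ℤ.- + s)))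
              (sym (indicator-cong (blockℕ B a <? j) (⟦ σ ⟧ a <? s) (extends⇒prefix B σ σ-ext a j))) ⟩
    + 1 ℤ.+ ((+ ⟦ σ ⟧ a ℤ.+ + n ℤ.* e a) ℤ.- + s) ℤ.+ (v a ℤ.- (+ n ℤ.* e a ℤ.- + s))
      ≡⟨ unwrap (+ ⟦ σ ⟧ a) (+ n ℤ.* e a) (+ s) (v a) ⟩
    + 1 ℤ.+ + ⟦ σ ⟧ a ℤ.+ v a ∎
    where
    open ≡-Reasoning
    unwrap : ∀ p q r u → + 1 ℤ.+ ((p ℤ.+ q) ℤ.- r) ℤ.+ (u ℤ.- (q ℤ.- r)) ≡ + 1 ℤ.+ p ℤ.+ u
    unwrap = solve-∀

  sameFace : SameFace B v B′ v′
  sameFace x = mk⇔ (face-transport B B′ v v′ (_∘ₚ ρ) forward)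
                   (face-transport B′ B v′ v (_∘ₚ flip ρ) backward)
    where
    forward : ∀ σ → VertexOf B σ →
      VertexOf B′ (σ ∘ₚ ρ) × (∀ a → vertexPoint (σ ∘ₚ ρ) v′ a ≡ vertexPoint σ v a)
    forward σ σ∈B = extends⇒vertex B′ {σ ∘ₚ ρ} (extends-forward σ σ-ext) , vertexPoint-forward σ σ-ext
      where
      σ-ext : Extends ⟦ σ ⟧ (blockℕ B)
      σ-ext = vertex⇒extends B {σ} σ∈B
    backward : ∀ τ → VertexOf B′ τ →
      VertexOf B (τ ∘ₚ flip ρ) × (∀ a → vertexPoint (τ ∘ₚ flip ρ) v a ≡ vertexPoint τ v′ a)
    backward τ τ∈B′ = extends⇒vertex B {τ ∘ₚ flip ρ} σ-ext , λ a → sym (trans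
      (cong (λ y → + suc (toℕ y) ℤ.+ v′ a) (sym (inverseʳ ρ))) (vertexPoint-forward (τ ∘ₚ flip ρ) σ-ext a))
      where
      σ-ext : Extends ⟦ τ ∘ₚ flip ρ ⟧ (blockℕ B)
      σ-ext = extends-backward τ (vertex⇒extends B′ {τ} τ∈B′)

oneInFirst-representative : ∀ {m k} (B : OrderedPartition (suc m) k) (v : Fin (suc m) → ℤ) → InLattice v →
  ∃₂ λ (B′ : OrderedPartition (suc m) k) (v′ : Fin (suc m) → ℤ) →
    OneInFirst B′ × InLattice v′ × SameFace B v B′ v′
oneInFirst-representative B v v∈Λ = B′ , v′ , B′-oneInFirst , v′-inLattice v∈Λ , sameFace
  where open RotatedFace B v

-- Uniqueness

offsets-equal : ∀ {m k} (B B′ : OrderedPartition (suc m) k) {v v′ : Fin (suc m) → ℤ} →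
  OneInFirst B → OneInFirst B′ → InLattice v → InLattice v′ → SameFace B v B′ v′ → ∀ j → v j ≡ v′ j
offsets-equal {m} B B′ {v} {v′} B-first B′-first v∈Λ v′∈Λ same j =
  bounded-multiple⇒≡ {suc m} {proj₁ congruent} {v j} {v′ j} (trans (sym (proj₂ congruent)) drop-zero)
    (below-n σ′ j (v-v′< j)) (below-n σ j (v′-v< j))
  where
  σ σ′ : Permutation′ (suc m)
  σ = canonicalVertex B
  σ′ = canonicalVertex B′
  v′-v< : ∀ j → v′ j ℤ.- v j ℤ.< + suc (⟦ σ ⟧ j)
  v′-v< = vertexPoint∈face⇒offset-< B′ σ v′
    (to (same _) (vertexPoint-inFace B σ v (extends⇒vertex B {σ} (canonicalVertex-extends B))))
  v-v′< : ∀ j → v j ℤ.- v′ j ℤ.< + suc (⟦ σ′ ⟧ j)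
  v-v′< = vertexPoint∈face⇒offset-< B σ′ v
    (from (same _) (vertexPoint-inFace B′ σ′ v′ (extends⇒vertex B′ {σ′} (canonicalVertex-extends B′))))
  below-n : ∀ {i} (τ : Permutation′ (suc m)) j → i ℤ.< + suc (⟦ τ ⟧ j) → i ℤ.< + suc m
  below-n τ j lt = ℤ.<-≤-trans lt (+≤+ (toℕ<n (τ ⟨$⟩ʳ j)))
  v₀≡v′₀ : v Fin.zero ≡ v′ Fin.zero
  v₀≡v′₀ = bounded-multiple⇒≡ {1} (ℤ.*-identityˡ _)
    (subst (λ z → _ ℤ.< + suc z) (canonicalVertex-first B′ B′-first) (v-v′< Fin.zero))
    (subst (λ z → _ ℤ.< + suc z) (canonicalVertex-first B B-first) (v′-v< Fin.zero))
  congruent : ∃ λ t → (v j ℤ.- v′ j) ℤ.- (v Fin.zero ℤ.- v′ Fin.zero) ≡ + suc m ℤ.* t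
  congruent = inLattice-congruent (inLattice-sub v∈Λ v′∈Λ) j Fin.zero
  drop-zero : (v j ℤ.- v′ j) ℤ.- (v Fin.zero ℤ.- v′ Fin.zero) ≡ v j ℤ.- v′ j
  drop-zero = trans (cong (λ z → (v j ℤ.- v′ j) ℤ.- (v Fin.zero ℤ.- z)) (sym v₀≡v′₀))
                    (minus-zero (v j ℤ.- v′ j) (v Fin.zero))
    where
    minus-zero : ∀ i k → i ℤ.- (k ℤ.- k) ≡ i
    minus-zero = solve-∀

representative-unique : ∀ {m k} (B B′ : OrderedPartition (suc m) k) (v v′ : Fin (suc m) → ℤ) →
  OneInFirst B → OneInFirst B′ → InLattice v → InLattice v′ → SameFace B v B′ v′ →
  (∀ a → block B a ≡ block B′ a) × (∀ j → v j ≡ v′ j)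
representative-unique B B′ v v′ B-first B′-first v∈Λ v′∈Λ same =
  same-vertices⇒same-blocks B B′ B⊆B′ B′⊆B , v≗v′
  where
  v≗v′ : ∀ j → v j ≡ v′ j
  v≗v′ = offsets-equal B B′ B-first B′-first v∈Λ v′∈Λ same
  B⊆B′ : ∀ σ → VertexOf B σ → VertexOf B′ σ
  B⊆B′ σ σ∈B = vertexPoint∈face⇒vertex B′ σ v
    (face-offset B′ (sym ∘ v≗v′) (to (same _) (vertexPoint-inFace B σ v σ∈B)))
  B′⊆B : ∀ σ → VertexOf B′ σ → VertexOf B σ
  B′⊆B σ σ∈B′ = vertexPoint∈face⇒vertex B σ v
    (from (same _) (face-offset B′ v≗v′ (vertexPoint-inFace B′ σ v σ∈B′)))

proposition5p4 : ∀ (d k : ℕ) → 2 ≤ d → 1 ≤ k → k ≤ suc d →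
    -- existence: every (d+1-k)-face [B]+v (B with k blocks, v ∈ Λ_d) has such a form
    (∀ (B : OrderedPartition (suc d) k) (v : Fin (suc d) → ℤ) → InLattice v →
       ∃₂ λ (B' : OrderedPartition (suc d) k) (v' : Fin (suc d) → ℤ) →
         OneInFirst B' × InLattice v' × SameFace B v B' v')
    ×
    -- uniqueness
    (∀ (B B' : OrderedPartition (suc d) k) (v v' : Fin (suc d) → ℤ) →
       OneInFirst B → OneInFirst B' → InLattice v → InLattice v' →
       SameFace B v B' v' →
       (∀ a → block B a ≡ block B' a) × (∀ j → v j ≡ v' j))
proposition5p4 d k _ _ _ = oneInFirst-representative , representative-unique
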